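{- Let $n\ge9$ and $n-m>m\ge4$. Then $F_{\{2,5,n-m+3\}}$ appears in the expansion of $\mathcal{S}_{(n-m,m)}$ in the basis of fundamental quasisymmetric functions with coefficient at least $2$.
   Context: For $S\subseteq[n-1]$, $F_S=\sum x_{i_1}\cdots x_{i_n}$ over $i_1\le\cdots\le i_n$ with $i_j<i_{j+1}$ whenever $j\in S$. The composition diagram of a composition $\alpha$ has $\alpha_i$ left-justified cells in row $i$ (top to bottom). Cover relation on compositions: $\beta\lessdot\gamma$ if $\gamma=(1)\cdot\beta$ (new top row of one cell, existing rows keeping their cells) or $\gamma$ is obtained from $\beta$ by adding $1$ to the leftmost part of $\beta$ equal to $k$, for some $k$ (cell added at the right end of that row). A standard composition tableau (SCT) of shape $\alpha\vDash n$ comes from a chain $\emptyset=\alpha^{n+1}\lessdot\cdots\lessdot\alpha^1=\alpha$ by putting $i$ in the cell added from $\alpha^{i+1}$ to $\alpha^i$. Its descent set $\mathrm{Des}(T)$ is the set of $i$ with $i+1$ in a column weakly right of the column of $i$. $\mathcal{S}_\alpha=\sum_T F_{\mathrm{Des}(T)}$ over SCT $T$ of shape $\alpha$. -}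

module Defs where

open import Data.Nat using (ℕ; zero; suc; _≤ᵇ_)
open import Data.List using (List; []; _∷_)
open import Data.Bool using (if_then_else_)
open import Relation.Binary.PropositionalEquality using (_≢_)

-- Compositions are lists of positive naturals, first entry = top row.
Composition : Set
Composition = List ℕ

data IncLeftmost (k : ℕ) : Composition → Composition → Set where
  here  : ∀ {β} → IncLeftmost k (k ∷ β) (suc k ∷ β)
  there : ∀ {j β γ} → j ≢ k → IncLeftmost k β γ → IncLeftmost k (j ∷ β) (j ∷ γ)

-- Cover β γ c : β ⋖ γ, and the added cell lies in column c (1-indexed).
data Cover : Composition → Composition → ℕ → Set where
  newRow : ∀ {β} → Cover β (1 ∷ β) 1
  grow   : ∀ {β γ} (k : ℕ) → IncLeftmost (suc k) β γ → Cover β γ (suc (suc k))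

-- A standard composition tableau of shape α is a saturated chain
-- ∅ = α^{n+1} ⋖ ⋯ ⋖ α^1 = α. The outermost step (α^2 ⋖ α^1) adds entry 1,
-- the next one entry 2, etc.
data SCT : Composition → Set where
  empty : SCT []
  step  : ∀ {β γ c} → Cover β γ c → SCT β → SCT γ

cols : ∀ {α} → SCT α → List ℕ
cols empty        = []
cols (step {c = c} _ T) = c ∷ cols T

desAux : ℕ → List ℕ → List ℕ
desAux i (a ∷ b ∷ rest) =
  if a ≤ᵇ b then i ∷ desAux (suc i) (b ∷ rest) else desAux (suc i) (b ∷ rest)
desAux i _ = []

Des : ∀ {α} → SCT α → List ℕ
Des T = desAux 1 (cols T)

{-# OPTIONS --safe #-}
-- Write m = p + 4 and n − m = p + r + 5. Entries 6, …, n fill the top row up to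
-- column p + r + 3 and the bottom row up to column p + 1; their column word
-- p+r+3, …, 1, p+1, …, 1 descends only at the corner, entry n − m + 3. Entries
-- 1, …, 5 complete the shape in two orders, with column words
-- (p+r+5, p+4, p+r+4, p+3, p+2) and (p+4, p+3, p+r+5, p+r+4, p+2), each with the
-- single descent 2; and 5 is a descent since p + 2 ≤ p + r + 3.
module Submission where

open import Defs
open import Data.Nat using (ℕ; zero; suc; _+_; _∸_; _≤_; _<_; _≤ᵇ_; z≤n; s≤s)
open import Data.Nat.Properties
  using (≤ᵇ-reflects-≤; <⇒≱; >⇒≢; <⇒≢; m≤m+n; m≤n⇒m≤1+n; m≤n⇒m≤o+n; n<1+n; +-comm; +-identityʳ; +-suc; m≤n⇒∃[o]m+o≡n)
open import Data.List using (List; []; _∷_; _++_)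
open import Data.List.Properties using (∷-injectiveˡ)
open import Data.Bool using (true; false)
open import Data.Product using (Σ; _×_; _,_)
open import Function using (_$_)
open import Relation.Nullary using (contradiction)
open import Relation.Nullary.Reflects using (ofʸ; ofⁿ)
open import Relation.Binary.PropositionalEquality using (_≡_; _≢_; refl; sym; cong; cong₂; trans; module ≡-Reasoning)

countdown : ℕ → List ℕ
countdown zero    = []
countdown (suc k) = suc k ∷ countdown k

desAux-≤ : ∀ {i a b} rest → a ≤ b → desAux i (a ∷ b ∷ rest) ≡ i ∷ desAux (suc i) (b ∷ rest)
desAux-≤ {a = a} {b} _ a≤b with a ≤ᵇ b | ≤ᵇ-reflects-≤ a b
... | true  | _       = refl
... | false | ofⁿ a≰b = contradiction a≤b a≰b

desAux-> : ∀ {i a b} rest → b < a → desAux i (a ∷ b ∷ rest) ≡ desAux (suc i) (b ∷ rest)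
desAux-> {a = a} {b} _ b<a with a ≤ᵇ b | ≤ᵇ-reflects-≤ a b
... | false | _       = refl
... | true  | ofʸ a≤b = contradiction a≤b (<⇒≱ b<a)

desAux-countdown : ∀ i k → desAux i (countdown (suc k)) ≡ []
desAux-countdown i zero    = refl
desAux-countdown i (suc k) = trans (desAux-> (countdown k) (n<1+n (suc k))) (desAux-countdown (suc i) k)

desAux-countdown-++ : ∀ i k l → desAux i (countdown (suc k) ++ countdown (suc l)) ≡ (i + k) ∷ []
desAux-countdown-++ i zero l =
  trans (desAux-≤ (countdown l) (s≤s z≤n)) $
  cong₂ _∷_ (sym (+-identityʳ i)) (desAux-countdown (suc i) l)
desAux-countdown-++ i (suc k) l =
  trans (desAux-> (countdown k ++ countdown (suc l)) (n<1+n (suc k))) $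
  trans (desAux-countdown-++ (suc i) k l) (cong (_∷ []) (sym (+-suc i k)))

desAux-down-up-down-down : ∀ {c₁ c₂ c₃ c₄ c₅} rest → c₂ < c₁ → c₂ ≤ c₃ → c₄ < c₃ → c₅ < c₄ →
  desAux 1 (c₁ ∷ c₂ ∷ c₃ ∷ c₄ ∷ c₅ ∷ rest) ≡ 2 ∷ desAux 5 (c₅ ∷ rest)
desAux-down-up-down-down {c₃ = c₃} {c₄} {c₅} rest c₂<c₁ c₂≤c₃ c₄<c₃ c₅<c₄ =
  trans (desAux-> (c₃ ∷ c₄ ∷ c₅ ∷ rest) c₂<c₁) $
  trans (desAux-≤ (c₄ ∷ c₅ ∷ rest) c₂≤c₃) $ cong (2 ∷_) $
  trans (desAux-> (c₅ ∷ rest) c₄<c₃)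
        (desAux-> rest c₅<c₄)

singleRow : (k : ℕ) → SCT (suc k ∷ [])
singleRow zero    = step newRow empty
singleRow (suc k) = step (grow k here) (singleRow k)

cols-singleRow : ∀ k → cols (singleRow k) ≡ countdown (suc k)
cols-singleRow zero    = refl
cols-singleRow (suc k) = cong (suc (suc k) ∷_) (cols-singleRow k)

twoRows : (j l : ℕ) → SCT (suc j ∷ suc l ∷ [])
twoRows zero    l = step newRow (singleRow l)
twoRows (suc j) l = step (grow j here) (twoRows j l)

cols-twoRows : ∀ j l → cols (twoRows j l) ≡ countdown (suc j) ++ countdown (suc l)
cols-twoRows zero    l = cong (1 ∷_) (cols-singleRow l)
cols-twoRows (suc j) l = cong (suc (suc j) ∷_) (cols-twoRows j l)

desAux-∷-twoRows : ∀ i {x} j l → x ≤ suc j → desAux i (x ∷ cols (twoRows j l)) ≡ i ∷ (suc i + j) ∷ []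
desAux-∷-twoRows i {x} j l x≤ = begin
  desAux i (x ∷ cols (twoRows j l))
    ≡⟨ cong (λ cs → desAux i (x ∷ cs)) (cols-twoRows j l) ⟩
  desAux i (x ∷ countdown (suc j) ++ countdown (suc l))
    ≡⟨ desAux-≤ (countdown j ++ countdown (suc l)) x≤ ⟩
  i ∷ desAux (suc i) (countdown (suc j) ++ countdown (suc l))
    ≡⟨ cong (i ∷_) (desAux-countdown-++ (suc i) j l) ⟩
  i ∷ (suc i + j) ∷ []
    ∎
  where open ≡-Reasoning

growTop : ∀ {j β} → SCT (suc j ∷ β) → SCT (suc (suc j) ∷ β)
growTop = step (grow _ here)

growBottom : ∀ {j k} → suc k < j → SCT (j ∷ suc k ∷ []) → SCT (j ∷ suc (suc k) ∷ [])
growBottom k<j = step (grow _ (there (>⇒≢ k<j) here))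

module _ (p r : ℕ) where

  hook : SCT (3 + p + r ∷ 1 + p ∷ [])
  hook = twoRows (2 + p + r) p

  T₁ T₂ : SCT (5 + p + r ∷ 4 + p ∷ [])
  T₁ = growTop $ growBottom (m≤m+n (4 + p) r) $ growTop $
       growBottom (m≤m+n (3 + p) r) $ growBottom (m≤n⇒m≤1+n (m≤m+n (2 + p) r)) hook
  T₂ = growBottom (m≤n⇒m≤1+n (m≤m+n (4 + p) r)) $ growBottom (m≤n⇒m≤o+n 2 (m≤m+n (3 + p) r)) $
       growTop $ growTop $ growBottom (m≤n⇒m≤1+n (m≤m+n (2 + p) r)) hook

  T₁≢T₂ : T₁ ≢ T₂
  T₁≢T₂ e = <⇒≢ (m≤m+n (5 + p) r) (sym (∷-injectiveˡ (cong cols e)))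

  Des-tail : desAux 5 (2 + p ∷ cols hook) ≡ 5 ∷ (5 + p + r + 3) ∷ []
  Des-tail = trans (desAux-∷-twoRows 5 (2 + p + r) p (m≤n⇒m≤o+n 1 (m≤m+n (2 + p) r)))
                   (cong (λ x → 5 ∷ x ∷ []) (+-comm 3 (5 + p + r)))

  Des-T₁ : Des T₁ ≡ 2 ∷ 5 ∷ (5 + p + r + 3) ∷ []
  Des-T₁ = trans (desAux-down-up-down-down (cols hook)
                   (m≤m+n (5 + p) r) (m≤m+n (4 + p) r) (m≤m+n (4 + p) r) (n<1+n (2 + p)))
                 (cong (2 ∷_) Des-tail)

  Des-T₂ : Des T₂ ≡ 2 ∷ 5 ∷ (5 + p + r + 3) ∷ []
  Des-T₂ = trans (desAux-down-up-down-down (cols hook)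
                   (n<1+n (3 + p)) (m≤n⇒m≤o+n 2 (m≤m+n (3 + p) r)) (n<1+n (4 + p + r))
                   (m≤n⇒m≤o+n 1 (m≤m+n (3 + p) r)))
                 (cong (2 ∷_) Des-tail)

twoRow-twoSCTs-Des≡2∷5∷a+3 : (a b : ℕ) → 4 ≤ b → b < a →
  Σ (SCT (a ∷ b ∷ [])) λ T₁ → Σ (SCT (a ∷ b ∷ [])) λ T₂ →
    T₁ ≢ T₂ × Des T₁ ≡ 2 ∷ 5 ∷ (a + 3) ∷ [] × Des T₂ ≡ 2 ∷ 5 ∷ (a + 3) ∷ []
twoRow-twoSCTs-Des≡2∷5∷a+3 a _ (s≤s (s≤s (s≤s (s≤s {n = p} z≤n)))) b<a with m≤n⇒∃[o]m+o≡n b<a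
... | r , refl = T₁ p r , T₂ p r , T₁≢T₂ p r , Des-T₁ p r , Des-T₂ p r

-- 9 ≤ n is implied by 4 ≤ m < n ∸ m.
lemma5p4 : (n m : ℕ) → 9 ≤ n → 4 ≤ m → m < n ∸ m →
    Σ (SCT ((n ∸ m) ∷ m ∷ [])) λ T₁ → Σ (SCT ((n ∸ m) ∷ m ∷ [])) λ T₂ →
      T₁ ≢ T₂ × Des T₁ ≡ 2 ∷ 5 ∷ (n ∸ m + 3) ∷ [] × Des T₂ ≡ 2 ∷ 5 ∷ (n ∸ m + 3) ∷ []
lemma5p4 n m _ 4≤m m<n∸m = twoRow-twoSCTs-Des≡2∷5∷a+3 (n ∸ m) m 4≤m m<n∸m
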